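{- For every integer $k\ge 1$ let $G^k$, $p^k_b$ and $p^k_e$ be as defined in the context. Then the reconfiguration distance between $p^k_b$ and $p^k_e$ in the reconfiguration graph of shortest $(s,t)$-paths of $G^k$ is $\Theta(2^k)$; that is, there are constants $c_1,c_2>0$ such that for all $k\ge 1$ this distance lies between $c_1 2^k$ and $c_2 2^k$.
   Context: Reconfiguration graph of shortest $(s,t)$-paths of a graph: its vertices are the shortest $(s,t)$-paths (viewed as vertex sequences), and two of them are adjacent iff, as sequences, they differ in exactly one position. The reconfiguration distance between two shortest paths is their distance in this graph. The undirected graph $G^1$ has vertices $x^1_1,\dots,x^1_7$, $y^1_1,\dots,y^1_6$, $s$, $t$ and edges $x^1_iy^1_i$, $x^1_{i+1}y^1_i$, $y^1_it$ for $1\le i\le 6$, and $sx^1_i$ for $1\le i\le 7$. For $k\ge 2$, $G^k$ has vertex set $V(G^{k-1})\cup\{x^k_1,\dots,x^k_7,y^k_1,\dots,y^k_6\}$ and edge set consisting of: $x^k_iy^k_i$ and $x^k_{i+1}y^k_i$ for $1\le i\le 6$; $y^k_ix^{k-1}_j$ for $i\in\{1,3,5\}$ and $1\le j\le 7$; $y^k_2x^{k-1}_1$, $y^k_4x^{k-1}_7$, $y^k_6x^{k-1}_1$; all edges of $G^{k-1}$ not incident to $s$; and $sx^k_i$ for $1\le i\le 7$. Let $p^k_b=s,x^k_1,y^k_1,x^{k-1}_1,y^{k-1}_1,\dots,x^1_1,y^1_1,t$ and $p^k_e=s,x^k_7,y^k_6,x^{k-1}_1,y^{k-1}_1,\dots,x^1_1,y^1_1,t$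 (both are shortest $(s,t)$-paths in $G^k$). -}

module Defs where

open import Data.Nat using (ℕ; zero; suc; _≤_; _∸_)
open import Data.List using (List; []; _∷_; _++_)
open import Data.List.Relation.Unary.Linked using (Linked)
open import Data.List.Relation.Unary.Unique.Propositional using (Unique)
open import Data.List using (length)
open import Data.Product using (Σ; _×_)
open import Data.Sum using (_⊎_)
open import Relation.Binary.PropositionalEquality using (_≡_; _≢_)

-- Vertices of all the graphs G^k.
--   x j i  stands for x^j_i   (layer j ≥ 1, 1 ≤ i ≤ 7)
--   y j i  stands for y^j_i   (layer j ≥ 1, 1 ≤ i ≤ 6)
data V : Set where
  s t : V
  x y : ℕ → ℕ → V

-- Edges of G^k (one orientation each; adjacency is the symmetric closure).
-- G^k consists of: layer-internal edges of every layer 1..k, the edges y^1_i t,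
-- the inter-layer edges between layer j+1 and layer j for 1 ≤ j, j+1 ≤ k,
-- and the edges s x^k_i (only to the top layer k, since the s-edges of
-- G^{k-1} are dropped).
data E (k : ℕ) : V → V → Set where
  xy   : ∀ {j i} → 1 ≤ j → j ≤ k → 1 ≤ i → i ≤ 6 → E k (x j i) (y j i)
  x'y  : ∀ {j i} → 1 ≤ j → j ≤ k → 1 ≤ i → i ≤ 6 → E k (x j (suc i)) (y j i)
  yt   : ∀ {i} → 1 ≤ k → 1 ≤ i → i ≤ 6 → E k (y 1 i) t
  y1x  : ∀ {j m} → 1 ≤ j → suc j ≤ k → 1 ≤ m → m ≤ 7 → E k (y (suc j) 1) (x j m)
  y3x  : ∀ {j m} → 1 ≤ j → suc j ≤ k → 1 ≤ m → m ≤ 7 → E k (y (suc j) 3) (x j m)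
  y5x  : ∀ {j m} → 1 ≤ j → suc j ≤ k → 1 ≤ m → m ≤ 7 → E k (y (suc j) 5) (x j m)
  y2x  : ∀ {j} → 1 ≤ j → suc j ≤ k → E k (y (suc j) 2) (x j 1)
  y4x  : ∀ {j} → 1 ≤ j → suc j ≤ k → E k (y (suc j) 4) (x j 7)
  y6x  : ∀ {j} → 1 ≤ j → suc j ≤ k → E k (y (suc j) 6) (x j 1)
  sx   : ∀ {i} → 1 ≤ k → 1 ≤ i → i ≤ 7 → E k s (x k i)

Adj : ℕ → V → V → Set
Adj k u v = E k u v ⊎ E k v u

IsSTPath : ℕ → List V → Set
IsSTPath k p = Σ (List V) (λ mid → p ≡ (s ∷ mid) ++ (t ∷ []))
             × Linked (Adj k) p
             × Unique p

IsShortest : ℕ → List V → Set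
IsShortest k p = IsSTPath k p × (∀ q → IsSTPath k q → length p ≤ length q)

data DiffOne : List V → List V → Set where
  here  : ∀ {u v us vs} → u ≢ v → us ≡ vs → DiffOne (u ∷ us) (v ∷ vs)
  there : ∀ {u us vs} → DiffOne us vs → DiffOne (u ∷ us) (u ∷ vs)

-- Walks in the reconfiguration graph of shortest (s,t)-paths of G^k:
-- Reach k p q n  means there is a walk of n steps from p to q.
data Reach (k : ℕ) : List V → List V → ℕ → Set where
  stop : ∀ {p} → IsShortest k p → Reach k p p 0
  step : ∀ {p q r n} → IsShortest k p → DiffOne p q → Reach k q r n →
         Reach k p r (suc n)

RDist : ℕ → List V → List V → ℕ → Set
RDist k p q d = Reach k p q d × (∀ n → Reach k p q n → d ≤ n)

chain : ℕ → List V
chain zero    = []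
chain (suc j) = x (suc j) 1 ∷ y (suc j) 1 ∷ chain j

pb : ℕ → List V
pb k = s ∷ chain k ++ (t ∷ [])

pe : ℕ → List V
pe k = s ∷ x k 7 ∷ y k 6 ∷ chain (k ∸ 1) ++ (t ∷ [])

-- Give s level 2k+1, x^j level 2j, y^j level 2j-1 and t level 0.  Every edge of G^k
-- joins consecutive levels, so a shortest (s,t)-path descends one level per step and is
-- determined by the pair (a , b) of vertices x^j_a, y^j_b it uses in each layer j; two
-- shortest paths are adjacent iff these configurations differ in a single coordinate.
-- Within a layer the admissible pairs are the 12 edges of the zigzag x_1 y_1 x_2 ... y_6 x_7,
-- and a + b climbs from 2 to 13 along it.  To climb layer j+1 from 2 to 13 one must pass
-- a + b = 4 (y_2, forcing x^j_1 below), 8 (y_4, forcing x^j_7) and 12 (y_6, forcing x^j_1),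
-- so layer j is crossed twice, and this suffices.  Hence the distance D k satisfies
-- D k = 11 + 2 D (k-1), i.e. D k = 11 (2^k - 1).
module Submission where

open import Defs
open import Data.Nat using (ℕ; _≤_; _<_; _*_; _^_)
open import Data.Product using (Σ; _×_)
open import Data.Bool using (T)
open import Data.Nat using (zero; suc; _+_; _≤ᵇ_; _≟_; z≤n; s≤s)
open import Data.Nat.Properties
open import Data.Nat.Tactic.RingSolver using (solve-∀)
open import Data.Product using (_,_; proj₁; proj₂; ∃-syntax; ∃₂)
open import Data.Sum using (_⊎_; inj₁; inj₂)
open import Data.Unit using (⊤; tt)
open import Data.Empty using (⊥; ⊥-elim)
open import Data.List using (List; []; _∷_; _++_; length)
open import Data.List.Properties using (∷-injective; ∷-injectiveʳ; ∷ʳ-injectiveˡ; length-++)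
open import Data.List.Relation.Unary.Linked as Linked using (Linked; []; [-]; _∷_)
open import Data.List.Relation.Unary.Linked.Properties using (Linked⇒AllPairs)
open import Data.List.Relation.Unary.Unique.Propositional using (Unique)
import Data.List.Relation.Unary.AllPairs as AllPairs
open import Data.Vec using (Vec; []; _∷_; replicate; tail)
open import Function using (_∘_)
open import Relation.Binary.PropositionalEquality
open import Relation.Nullary using (yes; no)
open ≤-Reasoning hiding (stop)

lit : ∀ {m n} {_ : T (m ≤ᵇ n)} → m ≤ n
lit {m} {n} {m≤ᵇn} = ≤ᵇ⇒≤ m n m≤ᵇn

level : ℕ → V → ℕ
level k s             = suc (k + k)
level k t             = 0
level k (x j _)       = j + j
level k (y zero _)    = 0
level k (y (suc j) _) = suc (j + j)

E-descends : ∀ {k u v} → E k u v → level k u ≡ suc (level k v)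
E-descends (xy {suc j} _ _ _ _)  = cong suc (+-suc j j)
E-descends (x'y {suc j} _ _ _ _) = cong suc (+-suc j j)
E-descends (yt _ _ _)            = refl
E-descends (y1x _ _ _ _)         = refl
E-descends (y3x _ _ _ _)         = refl
E-descends (y5x _ _ _ _)         = refl
E-descends (y2x _ _)             = refl
E-descends (y4x _ _)             = refl
E-descends (y6x _ _)             = refl
E-descends (sx _ _ _)            = refl

Adj-level-≤ : ∀ {k u v} → Adj k u v → level k u ≤ suc (level k v)
Adj-level-≤ (inj₁ e) = ≤-reflexive (E-descends e)
Adj-level-≤ (inj₂ e) = ≤-trans (n≤1+n _) (≤-trans (≤-reflexive (sym (E-descends e))) (n≤1+n _))

level≤length : ∀ {k} u mid → Linked (Adj k) (u ∷ mid ++ t ∷ []) → level k u ≤ suc (length mid)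
level≤length u []        (a ∷ [-]) = Adj-level-≤ a
level≤length u (w ∷ mid) (a ∷ l)   = ≤-trans (Adj-level-≤ a) (s≤s (level≤length w mid l))

tight⇒oriented : ∀ {k} u mid → Linked (Adj k) (u ∷ mid ++ t ∷ []) →
                 level k u ≡ suc (length mid) → Linked (E k) (u ∷ mid ++ t ∷ [])
tight⇒oriented u []        (inj₁ e ∷ [-]) _ = e ∷ [-]
tight⇒oriented u []        (inj₂ () ∷ [-]) _
tight⇒oriented u (w ∷ mid) (inj₁ e ∷ l) tight =
  e ∷ tight⇒oriented w mid l (suc-injective (trans (sym (E-descends e)) tight))
tight⇒oriented u (w ∷ mid) (inj₂ e ∷ l) tight =
  ⊥-elim (1+n≰n (≤-trans (n≤1+n _) (≤-pred too-high)))
  where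
  too-high : suc (suc (suc (length mid))) ≤ suc (length mid)
  too-high = ≤-trans (≤-reflexive (sym (trans (E-descends e) (cong suc tight)))) (level≤length w mid l)

oriented-unique : ∀ {k l} → Linked (E k) l → Unique l
oriented-unique {k} =
  AllPairs.map (λ lt eq → <-irrefl (cong (level k) (sym eq)) lt)
  ∘ Linked⇒AllPairs (λ p q → <-trans q p)
  ∘ Linked.map (λ e → ≤-reflexive (sym (E-descends e)))

-- A configuration lists, from the top layer down, the indices (a , b) of the vertices
-- x^j_a and y^j_b used by a shortest path.
Config : ℕ → Set
Config = Vec (ℕ × ℕ)

layers : ∀ {j} → Config j → List V
layers []                    = []
layers {suc j} ((a , b) ∷ c) = x (suc j) a ∷ y (suc j) b ∷ layers c

path : ∀ {k} → Config k → List V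
path c = s ∷ layers c ++ t ∷ []

data Rung : ℕ → ℕ → Set where
  straight : ∀ {i} → 1 ≤ i → i ≤ 6 → Rung i i
  slanted  : ∀ {i} → 1 ≤ i → i ≤ 6 → Rung (suc i) i

data Link : ℕ → ℕ → Set where
  link₁ : ∀ {a} → 1 ≤ a → a ≤ 7 → Link 1 a
  link₃ : ∀ {a} → 1 ≤ a → a ≤ 7 → Link 3 a
  link₅ : ∀ {a} → 1 ≤ a → a ≤ 7 → Link 5 a
  link₂ : Link 2 1
  link₄ : Link 4 7
  link₆ : Link 6 1

LinksTo : ∀ {j} → ℕ → Config j → Set
LinksTo b []            = ⊤
LinksTo b ((a , _) ∷ _) = Link b a

data Valid : ∀ {j} → Config j → Set where
  []    : Valid []
  layer : ∀ {j a b} {c : Config j} → Rung a b → LinksTo b c → Valid c → Valid ((a , b) ∷ c)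

rung-x-bounds : ∀ {a b} → Rung a b → 1 ≤ a × a ≤ 7
rung-x-bounds (straight 1≤i i≤6) = 1≤i , m≤n⇒m≤1+n i≤6
rung-x-bounds (slanted _ i≤6)    = s≤s z≤n , s≤s i≤6

rung-y-bounds : ∀ {a b} → Rung a b → 1 ≤ b × b ≤ 6
rung-y-bounds (straight 1≤i i≤6) = 1≤i , i≤6
rung-y-bounds (slanted 1≤i i≤6)  = 1≤i , i≤6

rung-y≤x : ∀ {a b} → Rung a b → b ≤ a
rung-y≤x (straight _ _) = ≤-refl
rung-y≤x (slanted _ _)  = n≤1+n _

rung-x≤1+y : ∀ {a b} → Rung a b → a ≤ suc b
rung-x≤1+y (straight _ _) = n≤1+n _
rung-x≤1+y (slanted _ _)  = ≤-refl

rung-edge : ∀ {k j a b} → Rung a b → 1 ≤ j → j ≤ k → E k (x j a) (y j b)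
rung-edge (straight 1≤i i≤6) 1≤j j≤k = xy 1≤j j≤k 1≤i i≤6
rung-edge (slanted 1≤i i≤6)  1≤j j≤k = x'y 1≤j j≤k 1≤i i≤6

link-edge : ∀ {k j a b} → Link b a → 1 ≤ j → suc j ≤ k → E k (y (suc j) b) (x j a)
link-edge (link₁ 1≤a a≤7) 1≤j j<k = y1x 1≤j j<k 1≤a a≤7
link-edge (link₃ 1≤a a≤7) 1≤j j<k = y3x 1≤j j<k 1≤a a≤7
link-edge (link₅ 1≤a a≤7) 1≤j j<k = y5x 1≤j j<k 1≤a a≤7
link-edge link₂           1≤j j<k = y2x 1≤j j<k
link-edge link₄           1≤j j<k = y4x 1≤j j<k
link-edge link₆           1≤j j<k = y6x 1≤j j<k

layers-oriented : ∀ {k j} {c : Config (suc j)} → Valid c → suc j ≤ k → Linked (E k) (layers c ++ t ∷ [])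
layers-oriented {c = _ ∷ []} (layer r _ []) j<k =
  rung-edge r (s≤s z≤n) j<k
  ∷ yt (≤-trans (s≤s z≤n) j<k) (proj₁ (rung-y-bounds r)) (proj₂ (rung-y-bounds r))
  ∷ [-]
layers-oriented {c = _ ∷ _ ∷ _} (layer r l v) j<k =
  rung-edge r (s≤s z≤n) j<k ∷ link-edge l (s≤s z≤n) j<k ∷ layers-oriented v (≤-trans (n≤1+n _) j<k)

path-oriented : ∀ {k} {c : Config (suc k)} → Valid c → Linked (E (suc k)) (path c)
path-oriented v@(layer r _ _) =
  sx (s≤s z≤n) (proj₁ (rung-x-bounds r)) (proj₂ (rung-x-bounds r)) ∷ layers-oriented v ≤-refl

length-terminated : ∀ l → length (s ∷ l ++ t ∷ []) ≡ suc (suc (length l))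
length-terminated l = cong suc (trans (length-++ l) (+-comm (length l) 1))

length-path : ∀ {k} (c : Config k) → length (path c) ≡ suc (suc (k + k))
length-path c = trans (length-terminated (layers c)) (cong (suc ∘ suc) (length-layers c))
  where
  length-layers : ∀ {j} (c : Config j) → length (layers c) ≡ j + j
  length-layers []                    = refl
  length-layers {suc j} ((a , b) ∷ c) = cong suc (trans (cong suc (length-layers c)) (sym (+-suc j j)))

path-shortest : ∀ {k} {c : Config (suc k)} → Valid c → IsShortest (suc k) (path c)
path-shortest {k} {c} v =
  ((layers c , refl) , Linked.map inj₁ (path-oriented v) , oriented-unique (path-oriented v)) , minimal
  where
  minimal : ∀ q → IsSTPath (suc k) q → length (path c) ≤ length q
  minimal _ ((mid , refl) , linked , _) = begin
    length (path c)                ≡⟨ length-path c ⟩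
    suc (level (suc k) s)          ≤⟨ s≤s (level≤length s mid linked) ⟩
    suc (suc (length mid))         ≡⟨ sym (length-terminated mid) ⟩
    length (s ∷ mid ++ t ∷ [])     ∎

ones : ∀ j → Config j
ones j = replicate j (1 , 1)

at-ones : ∀ {j a b} → Rung a b → Link b 1 → Valid ((a , b) ∷ ones j)
at-ones {zero}  r l = layer r tt []
at-ones {suc j} r l = layer r l (at-ones (straight lit lit) (link₁ lit lit))

ones-valid : ∀ j → Valid (ones j)
ones-valid zero    = []
ones-valid (suc j) = at-ones (straight lit lit) (link₁ lit lit)

rung-step : ∀ {k j a w} → E k (x j a) w → Σ ℕ λ b → w ≡ y j b × Rung a b
rung-step (xy _ _ 1≤i i≤6)  = _ , refl , straight 1≤i i≤6
rung-step (x'y _ _ 1≤i i≤6) = _ , refl , slanted 1≤i i≤6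

link-step : ∀ {k j b w} → E k (y (suc j) b) w → w ≡ t ⊎ (1 ≤ j × Σ ℕ λ a → w ≡ x j a × Link b a)
link-step (yt _ _ _)          = inj₁ refl
link-step (y1x 1≤j _ 1≤a a≤7) = inj₂ (1≤j , _ , refl , link₁ 1≤a a≤7)
link-step (y3x 1≤j _ 1≤a a≤7) = inj₂ (1≤j , _ , refl , link₃ 1≤a a≤7)
link-step (y5x 1≤j _ 1≤a a≤7) = inj₂ (1≤j , _ , refl , link₅ 1≤a a≤7)
link-step (y2x 1≤j _)         = inj₂ (1≤j , _ , refl , link₂)
link-step (y4x 1≤j _)         = inj₂ (1≤j , _ , refl , link₄)
link-step (y6x 1≤j _)         = inj₂ (1≤j , _ , refl , link₆)

no-edge-from-t : ∀ {k} mid → Linked (E k) (t ∷ mid ++ t ∷ []) → ⊥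
no-edge-from-t []      (() ∷ _)
no-edge-from-t (_ ∷ _) (() ∷ _)

decode-x : ∀ {k j a} mid → Linked (E k) (x (suc j) a ∷ mid ++ t ∷ []) →
           Σ ℕ λ b → Σ (Config j) λ c → Valid ((a , b) ∷ c) × mid ≡ y (suc j) b ∷ layers c
decode-y : ∀ {k j b} mid → Linked (E k) (y (suc j) b ∷ mid ++ t ∷ []) →
           Σ (Config j) λ c → LinksTo b c × Valid c × mid ≡ layers c

decode-x []        (() ∷ _)
decode-x (w ∷ mid) (e ∷ l) with rung-step e
... | b , refl , r with decode-y mid l
...   | c , links , v , refl = b , c , layer r links v , refl

decode-y []        (yt _ _ _ ∷ [-]) = [] , tt , [] , refl
decode-y (w ∷ mid) (e ∷ l) with link-step e
... | inj₁ refl = ⊥-elim (no-edge-from-t mid l)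
... | inj₂ (s≤s z≤n , a , refl , link) with decode-x mid l
...   | b , c , v , refl = (a , b) ∷ c , link , v , refl

decode-path : ∀ {k} mid → Linked (E (suc k)) (s ∷ mid ++ t ∷ []) →
              Σ (Config (suc k)) λ c → Valid c × s ∷ mid ++ t ∷ [] ≡ path c
decode-path []        (() ∷ _)
decode-path (w ∷ mid) (sx _ _ _ ∷ l) with decode-x mid l
... | b , c , v , refl = _ , v , refl

shortest-config : ∀ {k q} → IsShortest (suc k) q → Σ (Config (suc k)) λ c → Valid c × q ≡ path c
shortest-config {k} (((mid , refl) , linked , _) , minimal) =
  decode-path mid (tight⇒oriented s mid linked tight)
  where
  tight : level (suc k) s ≡ suc (length mid)
  tight = ≤-antisym (level≤length s mid linked) (≤-pred (begin
    suc (suc (length mid))       ≡⟨ sym (length-terminated mid) ⟩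
    length (s ∷ mid ++ t ∷ [])   ≤⟨ minimal _ (proj₁ (path-shortest (ones-valid (suc k)))) ⟩
    length (path (ones (suc k))) ≡⟨ length-path (ones (suc k)) ⟩
    suc (level (suc k) s)        ∎))

layers-injective : ∀ {j} {c c' : Config j} → layers c ≡ layers c' → c ≡ c'
layers-injective {c = []}          {[]}            _  = refl
layers-injective {c = (a , b) ∷ c} {(_ , _) ∷ c'} eq with ∷-injective eq
... | refl , eq′ with ∷-injective eq′
... | refl , eq″ = cong ((a , b) ∷_) (layers-injective eq″)

terminated-injective : ∀ {j} {c c' : Config j} → layers c ++ t ∷ [] ≡ layers c' ++ t ∷ [] → c ≡ c'
terminated-injective {c = c} {c'} = layers-injective ∘ ∷ʳ-injectiveˡ (layers c) (layers c')

path-injective : ∀ {k} {c c' : Config k} → path c ≡ path c' → c ≡ c'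
path-injective = terminated-injective ∘ ∷-injectiveʳ

data Move : ∀ {j} → Config j → Config j → Set where
  change-x : ∀ {j a a' b} {c : Config j} → a ≢ a' → Move ((a , b) ∷ c) ((a' , b) ∷ c)
  change-y : ∀ {j a b b'} {c : Config j} → b ≢ b' → Move ((a , b) ∷ c) ((a , b') ∷ c)
  below    : ∀ {j p} {c c' : Config j} → Move c c' → Move (p ∷ c) (p ∷ c')

Move-sym : ∀ {j} {c c' : Config j} → Move c c' → Move c' c
Move-sym (change-x a≢a') = change-x (≢-sym a≢a')
Move-sym (change-y b≢b') = change-y (≢-sym b≢b')
Move-sym (below m)       = below (Move-sym m)

move⇒diff : ∀ {j} {c c' : Config j} → Move c c' → DiffOne (layers c ++ t ∷ []) (layers c' ++ t ∷ [])
move⇒diff (change-x a≢a') = here (λ { refl → a≢a' refl }) refl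
move⇒diff (change-y b≢b') = there (here (λ { refl → b≢b' refl }) refl)
move⇒diff (below m)       = there (there (move⇒diff m))

diff⇒move : ∀ {j} {c c' : Config j} → DiffOne (layers c ++ t ∷ []) (layers c' ++ t ∷ []) → Move c c'
diff⇒move {c = []} {[]} (here t≢t _) = ⊥-elim (t≢t refl)
diff⇒move {c = _ ∷ _} {_ ∷ _} (here x≢x′ rest) with ∷-injective rest
... | refl , same with terminated-injective same
... | refl = change-x (λ { refl → x≢x′ refl })
diff⇒move {c = _ ∷ _} {_ ∷ _} (there (here y≢y′ same)) with terminated-injective same
... | refl = change-y (λ { refl → y≢y′ refl })
diff⇒move {c = _ ∷ _} {_ ∷ _} (there (there d)) = below (diff⇒move d)

path-diff⇒move : ∀ {k} {c c' : Config k} → DiffOne (path c) (path c') → Move c c'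
path-diff⇒move (here s≢s _) = ⊥-elim (s≢s refl)
path-diff⇒move (there d)    = diff⇒move d

data Walk {j} : Config j → Config j → ℕ → Set where
  stay : ∀ {c} → Valid c → Walk c c 0
  move : ∀ {c c₁ c₂ n} → Valid c → Move c c₁ → Walk c₁ c₂ n → Walk c c₂ (suc n)

walk-source-valid : ∀ {j} {c c' : Config j} {n} → Walk c c' n → Valid c
walk-source-valid (stay v)     = v
walk-source-valid (move v _ _) = v

infixr 5 _++ʷ_
_++ʷ_ : ∀ {j} {c₁ c₂ c₃ : Config j} {m n} → Walk c₁ c₂ m → Walk c₂ c₃ n → Walk c₁ c₃ (m + n)
stay _      ++ʷ w₂ = w₂
move v m w₁ ++ʷ w₂ = move v m (w₁ ++ʷ w₂)

reverse : ∀ {j} {c c' : Config j} {n} → Walk c c' n → Walk c' c n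
reverse (stay v) = stay v
reverse (move {n = n} v m w) =
  subst (Walk _ _) (+-comm n 1) (reverse w ++ʷ move (walk-source-valid w) (Move-sym m) (stay v))

links-to-any : ∀ {j b} {c : Config j} → (∀ {a} → 1 ≤ a → a ≤ 7 → Link b a) → Valid c → LinksTo b c
links-to-any free []            = tt
links-to-any free (layer r _ _) = free (proj₁ (rung-x-bounds r)) (proj₂ (rung-x-bounds r))

lift : ∀ {j a b} {c c' : Config j} {n} → Rung a b → (∀ {a'} → 1 ≤ a' → a' ≤ 7 → Link b a') →
       Walk c c' n → Walk ((a , b) ∷ c) ((a , b) ∷ c') n
lift r free (stay v)     = stay (layer r (links-to-any free v) v)
lift r free (move v m w) = move (layer r (links-to-any free v) v) (below m) (lift r free w)

walk⇒reach : ∀ {k} {c c' : Config (suc k)} {n} → Walk c c' n → Reach (suc k) (path c) (path c') n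
walk⇒reach (stay v)     = stop (path-shortest v)
walk⇒reach (move v m w) = step (path-shortest v) (there (move⇒diff m)) (walk⇒reach w)

reach-source-shortest : ∀ {k p q n} → Reach k p q n → IsShortest k p
reach-source-shortest (stop sp)     = sp
reach-source-shortest (step sp _ _) = sp

reach⇒walk : ∀ {k p q n} {c c' : Config (suc k)} →
             Reach (suc k) p q n → p ≡ path c → q ≡ path c' → Valid c → Walk c c' n
reach⇒walk (stop _) refl q≡ v with path-injective q≡
... | refl = stay v
reach⇒walk (step _ d r) refl q≡ v with shortest-config (reach-source-shortest r)
... | c₁ , v₁ , refl = move v (path-diff⇒move d) (reach⇒walk r refl q≡ v₁)

finish : ∀ j → Config j
finish zero    = []
finish (suc j) = (7 , 6) ∷ ones j

at-finish : ∀ {j a b} → Rung a b → Link b 7 → Valid ((a , b) ∷ finish j)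
at-finish {zero}  r l = layer r tt []
at-finish {suc j} r l = layer r l (at-ones (slanted lit lit) link₆)

D : ℕ → ℕ
D zero    = 0
D (suc j) = 11 + (D j + D j)

-- The layers below are crossed while the top layer rests on x_4 y_3 (between the pins
-- y_2 x_1 and y_4 x_7) and crossed back while it rests on x_5 y_5 (before the pin y_6 x_1).
traverse : ∀ j → Walk (ones j) (finish j) (D j)
traverse zero    = stay []
traverse (suc j) = subst (Walk (ones (suc j)) (finish (suc j))) (route-length (D j)) route
  where
  route-length : ∀ d → 5 + (d + (3 + (d + 3))) ≡ 11 + (d + d)
  route-length = solve-∀
  route : Walk (ones (suc j)) (finish (suc j)) (5 + (D j + (3 + (D j + 3))))
  route =
    move (at-ones (straight lit lit) (link₁ lit lit)) (change-x λ ()) (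
    move (at-ones (slanted lit lit) (link₁ lit lit)) (change-y λ ()) (
    move (at-ones (straight lit lit) link₂) (change-x λ ()) (
    move (at-ones (slanted lit lit) link₂) (change-y λ ()) (
    move (at-ones (straight lit lit) (link₃ lit lit)) (change-x λ ()) (
    lift (slanted lit lit) link₃ (traverse j) ++ʷ
    move (at-finish (slanted lit lit) (link₃ lit lit)) (change-y λ ()) (
    move (at-finish (straight lit lit) link₄) (change-x λ ()) (
    move (at-finish (slanted lit lit) link₄) (change-y λ ()) (
    lift (straight lit lit) link₅ (reverse (traverse j)) ++ʷ
    move (at-ones (straight lit lit) (link₅ lit lit)) (change-x λ ()) (
    move (at-ones (slanted lit lit) (link₅ lit lit)) (change-y λ ()) (
    move (at-ones (straight lit lit) link₆) (change-x λ ()) (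
    stay (at-ones (slanted lit lit) link₆))))))))))))

height : ∀ {j} → Config (suc j) → ℕ
height ((a , b) ∷ _) = a + b

height-step : ∀ {j} {c c' : Config (suc j)} →
              Valid c → Valid c' → Move c c' → height c' ≤ suc (height c)
height-step (layer r _ _) (layer r′ _ _) (change-x _) =
  +-monoˡ-≤ _ (≤-trans (rung-x≤1+y r′) (s≤s (rung-y≤x r)))
height-step {c = (a , b) ∷ _} (layer r _ _) (layer r′ _ _) (change-y _) =
  ≤-trans (+-monoʳ-≤ a (≤-trans (rung-y≤x r′) (rung-x≤1+y r))) (≤-reflexive (+-suc a b))
height-step _ _ (below _) = n≤1+n _

climb-head-move : ∀ {l h h₁ n} → h₁ ≤ suc h → l ≤ h₁ + n → l ≤ h + suc n
climb-head-move {h = h} {n = n} h₁≤ climb =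
  ≤-trans climb (≤-trans (+-monoˡ-≤ n h₁≤) (≤-reflexive (sym (+-suc h n))))

project : ∀ {j} {c c' : Config (suc j)} {n} → Walk c c' n →
          ∃[ m ] Walk (tail c) (tail c') m × height c' + m ≤ height c + n
project (stay (layer _ _ v)) = 0 , stay v , ≤-refl
project {c = c} {c'} (move (layer _ _ v) (below m) w) with project w
... | k , w′ , climb =
  suc k , move v m w′ , subst₂ _≤_ (sym (+-suc (height c') k)) (sym (+-suc (height c) _)) (s≤s climb)
project (move v m@(change-x _) w) with project w
... | k , w′ , climb = k , w′ , climb-head-move (height-step v (walk-source-valid w) m) climb
project (move v m@(change-y _) w) with project w
... | k , w′ , climb = k , w′ , climb-head-move (height-step v (walk-source-valid w) m) climb

split-at-height : ∀ {j} {c c' : Config (suc j)} {n} h → Walk c c' n → height c ≤ h → h ≤ height c' →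
  ∃[ c₁ ] height c₁ ≡ h × ∃₂ λ n₁ n₂ → Walk c c₁ n₁ × Walk c₁ c' n₂ × n₁ + n₂ ≡ n
split-at-height h (stay v) c≤h h≤c = _ , ≤-antisym c≤h h≤c , 0 , 0 , stay v , stay v , refl
split-at-height {c = c} h w@(move v m rest) c≤h h≤c′ with height c ≟ h
... | yes c≡h = c , c≡h , 0 , _ , stay v , w , refl
... | no c≢h with split-at-height h rest
                   (≤-trans (height-step v (walk-source-valid rest) m) (≤∧≢⇒< c≤h c≢h)) h≤c′
...   | c₁ , c₁≡h , n₁ , n₂ , w₁ , w₂ , sum =
  c₁ , c₁≡h , suc n₁ , n₂ , move v m w₁ , w₂ , cong suc sum

rung-height-even : ∀ {a b n} → Rung a b → a + b ≡ 2 * n → b ≡ n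
rung-height-even {n = n} (straight {i} _ _) eq =
  *-cancelˡ-≡ i n 2 (trans (cong (i +_) (+-identityʳ i)) eq)
rung-height-even {n = n} (slanted {i} _ _) eq =
  ⊥-elim (even≢odd n i (sym (trans (cong (λ m → suc (i + m)) (+-identityʳ i)) eq)))

height≡4⇒tail-height≤2 : ∀ {j} {c : Config (suc (suc j))} → Valid c → height c ≡ 4 → height (tail c) ≤ 2
height≡4⇒tail-height≤2 (layer r l (layer r′ _ _)) eq with rung-height-even {n = 2} r eq
height≡4⇒tail-height≤2 (layer r link₂ (layer r′ _ _)) eq | refl = s≤s (rung-y≤x r′)

height≡8⇒13≤tail-height : ∀ {j} {c : Config (suc (suc j))} → Valid c → height c ≡ 8 → 13 ≤ height (tail c)
height≡8⇒13≤tail-height (layer r l (layer r′ _ _)) eq with rung-height-even {n = 4} r eq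
height≡8⇒13≤tail-height (layer r link₄ (layer r′ _ _)) eq | refl =
  +-monoʳ-≤ 7 (≤-pred (rung-x≤1+y r′))

height≡12⇒tail-height≤2 : ∀ {j} {c : Config (suc (suc j))} → Valid c → height c ≡ 12 → height (tail c) ≤ 2
height≡12⇒tail-height≤2 (layer r l (layer r′ _ _)) eq with rung-height-even {n = 6} r eq
height≡12⇒tail-height≤2 (layer r link₆ (layer r′ _ _)) eq | refl = s≤s (rung-y≤x r′)

climb-trans : ∀ h₀ h₁ h₂ {m₁ m₂ n₁ n₂} → h₁ + m₁ ≤ h₀ + n₁ → h₂ + m₂ ≤ h₁ + n₂ →
              h₂ + (m₁ + m₂) ≤ h₀ + (n₁ + n₂)
climb-trans h₀ h₁ h₂ {m₁} {m₂} {n₁} {n₂} e₁ e₂ = +-cancelʳ-≤ h₁ _ _ (begin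
  h₂ + (m₁ + m₂) + h₁   ≡⟨ regroup h₂ m₁ m₂ h₁ ⟩
  h₂ + m₂ + (h₁ + m₁)   ≤⟨ +-mono-≤ e₂ e₁ ⟩
  h₁ + n₂ + (h₀ + n₁)   ≡⟨ regroup′ h₀ n₁ n₂ h₁ ⟩
  h₀ + (n₁ + n₂) + h₁   ∎)
  where
  regroup : ∀ a b c d → a + (b + c) + d ≡ a + c + (d + b)
  regroup = solve-∀
  regroup′ : ∀ a b c d → d + c + (a + b) ≡ a + (b + c) + d
  regroup′ = solve-∀

D≤crossing-length : ∀ j {c c' : Config (suc j)} {n} →
                    Walk c c' n → height c ≤ 2 → 13 ≤ height c' → D (suc j) ≤ n
D≤crossing-length zero w low high with project w
... | _ , _ , climb =
  +-cancelˡ-≤ 2 11 _ (≤-trans high (≤-trans (m≤m+n _ _) (≤-trans climb (+-monoˡ-≤ _ low))))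
D≤crossing-length (suc j) {c} {c'} w low high
  with split-at-height 4 w (≤-trans low lit) (≤-trans lit high)
... | c₄ , at₄ , n₁ , _ , w₁ , w′ , refl
  with split-at-height 8 w′ (≤-trans (≤-reflexive at₄) lit) (≤-trans lit high)
... | c₈ , at₈ , n₂ , _ , w₂ , w″ , refl
  with split-at-height 12 w″ (≤-trans (≤-reflexive at₈) lit) (≤-trans lit high)
... | c₁₂ , at₁₂ , n₃ , n₄ , w₃ , w₄ , refl
  with project w₁ | project w₂ | project w₃ | project w₄
... | m₁ , _ , e₁ | m₂ , t₂ , e₂ | m₃ , t₃ , e₃ | m₄ , _ , e₄ = +-cancelˡ-≤ 2 _ _ (begin
  13 + (D (suc j) + D (suc j))        ≤⟨ +-mono-≤ high tail-crossings ⟩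
  height c' + (m₁ + (m₂ + (m₃ + m₄))) ≤⟨ climbed ⟩
  height c + (n₁ + (n₂ + (n₃ + n₄)))  ≤⟨ +-monoˡ-≤ _ low ⟩
  2 + (n₁ + (n₂ + (n₃ + n₄)))         ∎)
  where
  climbed : height c' + (m₁ + (m₂ + (m₃ + m₄))) ≤ height c + (n₁ + (n₂ + (n₃ + n₄)))
  climbed = climb-trans (height c) (height c₄) (height c') e₁
              (climb-trans (height c₄) (height c₈) (height c') e₂
                (climb-trans (height c₈) (height c₁₂) (height c') e₃ e₄))
  tail-high : 13 ≤ height (tail c₈)
  tail-high = height≡8⇒13≤tail-height (walk-source-valid w₃) at₈
  tail-up : D (suc j) ≤ m₂
  tail-up = D≤crossing-length j t₂ (height≡4⇒tail-height≤2 (walk-source-valid w₂) at₄) tail-high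
  tail-down : D (suc j) ≤ m₃
  tail-down = D≤crossing-length j (reverse t₃)
                (height≡12⇒tail-height≤2 (walk-source-valid w₄) at₁₂) tail-high
  tail-crossings : D (suc j) + D (suc j) ≤ m₁ + (m₂ + (m₃ + m₄))
  tail-crossings = ≤-trans (+-mono-≤ tail-up tail-down) (≤-trans (+-monoʳ-≤ m₂ (m≤m+n m₃ m₄)) (m≤n+m _ m₁))

D+11≡11*2^ : ∀ j → D j + 11 ≡ 11 * 2 ^ j
D+11≡11*2^ zero    = refl
D+11≡11*2^ (suc j) = begin-equality
  11 + (D j + D j) + 11     ≡⟨ regroup (D j) ⟩
  (D j + 11) + (D j + 11)   ≡⟨ cong₂ _+_ (D+11≡11*2^ j) (D+11≡11*2^ j) ⟩
  11 * 2 ^ j + 11 * 2 ^ j   ≡⟨ double (2 ^ j) ⟩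
  11 * (2 * 2 ^ j)          ∎
  where
  regroup : ∀ d → 11 + (d + d) + 11 ≡ (d + 11) + (d + 11)
  regroup = solve-∀
  double : ∀ e → 11 * e + 11 * e ≡ 11 * (2 * e)
  double = solve-∀

D≤11*2^ : ∀ j → D j ≤ 11 * 2 ^ j
D≤11*2^ j = ≤-trans (m≤m+n (D j) 11) (≤-reflexive (D+11≡11*2^ j))

2^≤2*D : ∀ j → 2 ^ suc j ≤ 2 * D (suc j)
2^≤2*D j = *-monoʳ-≤ 2 (begin
  2 ^ j             ≤⟨ m≤n*m (2 ^ j) 11 ⟩
  11 * 2 ^ j        ≡⟨ sym (D+11≡11*2^ j) ⟩
  D j + 11          ≡⟨ +-comm (D j) 11 ⟩
  11 + D j          ≤⟨ +-monoʳ-≤ 11 (m≤m+n (D j) (D j)) ⟩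
  11 + (D j + D j)  ∎)

chain≡layers-ones : ∀ j → chain j ≡ layers (ones j)
chain≡layers-ones zero    = refl
chain≡layers-ones (suc j) = cong (λ l → x (suc j) 1 ∷ y (suc j) 1 ∷ l) (chain≡layers-ones j)

pb≡path : ∀ k → pb k ≡ path (ones k)
pb≡path k = cong (λ l → s ∷ l ++ t ∷ []) (chain≡layers-ones k)

pe≡path : ∀ k → pe (suc k) ≡ path (finish (suc k))
pe≡path k = cong (λ l → s ∷ x (suc k) 7 ∷ y (suc k) 6 ∷ l ++ t ∷ []) (chain≡layers-ones k)

distance : ∀ k → RDist (suc k) (pb (suc k)) (pe (suc k)) (D (suc k))
distance k = subst₂ (λ p q → Reach (suc k) p q (D (suc k))) (sym (pb≡path (suc k))) (sym (pe≡path k))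
                    (walk⇒reach (traverse (suc k)))
           , λ n r → D≤crossing-length k (reach⇒walk r (pb≡path (suc k)) (pe≡path k) (ones-valid (suc k)))
                                         ≤-refl ≤-refl

theorem1 : Σ ℕ (λ a → Σ ℕ (λ b → (0 < a) × (0 < b) ×
             ((k : ℕ) → 1 ≤ k → Σ ℕ (λ d →
                RDist k (pb k) (pe k) d × (2 ^ k ≤ a * d) × (d ≤ b * 2 ^ k)))))
theorem1 = 2 , 11 , s≤s z≤n , s≤s z≤n , λ where
  (suc k) _ → D (suc k) , distance k , 2^≤2*D k , D≤11*2^ (suc k)
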